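{- Let $n\geq2$ and let $e\colon\{1,\dots,n\}\to\mathbb{Z}_{\geq1}$ be a map. Then $e$ is binomial if and only if both of the following hold: (a) for all positive integers $i',l$ with $i'l\leq n$ and $1\leq l\leq e(i')$ one has $e(i'l)\mid\binom{e(i')}{l}$; and (b) for all $1\leq i'\leq i\leq n$ one has $e(i)\mid e(i')$.
   Context: $e$ is called binomial if for all positive integers $i,i',l$ with $i'l\leq i\leq n$ and $1\leq l\leq e(i')$ one has $e(i)\mid\binom{e(i')}{l}$. -}

module Defs where

open import Data.Nat using (ℕ; _*_; _≤_)
open import Data.Nat.Divisibility using (_∣_)
open import Data.Nat.Combinatorics using (_C_)
open import Data.Product using (_×_)

-- A map e : {1,…,n} → ℤ≥1 is modelled as e : ℕ → ℕ; only values e i with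
-- 1 ≤ i ≤ n are ever used (positivity is a hypothesis of the theorem).

Binomial : ℕ → (ℕ → ℕ) → Set
Binomial n e = ∀ i i' l → 1 ≤ i → 1 ≤ i' → 1 ≤ l →
  i' * l ≤ i → i ≤ n → l ≤ e i' → e i ∣ (e i') C l

CondA : ℕ → (ℕ → ℕ) → Set
CondA n e = ∀ i' l → 1 ≤ i' → 1 ≤ l → i' * l ≤ n → l ≤ e i' →
  e (i' * l) ∣ (e i') C l

CondB : ℕ → (ℕ → ℕ) → Set
CondB n e = ∀ i' i → 1 ≤ i' → i' ≤ i → i ≤ n → e i ∣ e i'

{-# OPTIONS --safe #-}
module Submission where

open import Defs
open import Data.Nat using (ℕ; _≤_; _*_; s≤s; z≤n)
open import Data.Nat.Properties using (≤-refl; ≤-trans; *-mono-≤; *-identityʳ)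
open import Data.Nat.Divisibility using (_∣_; ∣-trans)
open import Data.Nat.Combinatorics using (nC1≡n)
open import Data.Product using (_×_; _,_)
open import Function.Bundles using (_⇔_; mk⇔)
open import Relation.Binary.PropositionalEquality using (subst; sym)

-- (a) is the case i = i' l of binomiality; (b) is the case l = 1, since
-- e(i') C 1 = e(i'). Conversely e(i) ∣ e(i' l) ∣ e(i') C l by (b) then (a).

Binomial⇒CondA : ∀ {n} {e : ℕ → ℕ} → Binomial n e → CondA n e
Binomial⇒CondA binom i' l 1≤i' 1≤l i'l≤n l≤ei' =
  binom (i' * l) i' l (*-mono-≤ 1≤i' 1≤l) 1≤i' 1≤l ≤-refl i'l≤n l≤ei'

Binomial⇒CondB : ∀ {n} {e : ℕ → ℕ} → (∀ i → 1 ≤ i → i ≤ n → 1 ≤ e i) →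
  Binomial n e → CondB n e
Binomial⇒CondB {e = e} pos binom i' i 1≤i' i'≤i i≤n =
  subst (e i ∣_) (nC1≡n (e i'))
    (binom i i' 1 (≤-trans 1≤i' i'≤i) 1≤i' (s≤s z≤n) i'*1≤i i≤n
      (pos i' 1≤i' (≤-trans i'≤i i≤n)))
  where
  i'*1≤i : i' * 1 ≤ i
  i'*1≤i = subst (_≤ i) (sym (*-identityʳ i')) i'≤i

CondA×CondB⇒Binomial : ∀ {n} {e : ℕ → ℕ} → CondA n e × CondB n e → Binomial n e
CondA×CondB⇒Binomial (condA , condB) i i' l 1≤i 1≤i' 1≤l i'l≤i i≤n l≤ei' =
  ∣-trans (condB (i' * l) i (*-mono-≤ 1≤i' 1≤l) i'l≤i i≤n)
          (condA i' l 1≤i' 1≤l (≤-trans i'l≤i i≤n) l≤ei')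

lemma2p2 : (n : ℕ) → 2 ≤ n → (e : ℕ → ℕ) →
    (∀ i → 1 ≤ i → i ≤ n → 1 ≤ e i) →
    Binomial n e ⇔ (CondA n e × CondB n e)
lemma2p2 n _ e pos =
  mk⇔ (λ binom → Binomial⇒CondA binom , Binomial⇒CondB pos binom)
      CondA×CondB⇒Binomial
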